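{- Let $n\ge 10$. For each integer $a$ with $2\le a\le \lfloor (n-2)/3\rfloor$ and $n-a\equiv 0\pmod 2$, the partition $\left(\tfrac12(n-a),\ a+1,\ 2,\ 1\times\tfrac12(n-a-6)\right)$ of $n$ corresponds to the eigenvalue $\binom a2-1$ of $\mathrm{Cay}(S_n,T_n)$.
   Context: $\mathrm{Cay}(S_n,T_n)$ is the Cayley graph on the symmetric group $S_n$ generated by the set $T_n$ of all transpositions ($f\sim g$ iff $fg^{ -1}\in T_n$). For a partition $\lambda=(\lambda_1,\dots,\lambda_k)$ of $n$ (parts listed in the order written), put $\rho_\lambda=\sum_{i=1}^k \lambda_i(\lambda_i-2i+1)/2$; the eigenvalues of $\mathrm{Cay}(S_n,T_n)$ are exactly the numbers $\rho_\lambda$ as $\lambda$ ranges over partitions of $n$, and $\lambda$ is said to correspond to the eigenvalue $\rho_\lambda$. The notation $(\mu_1\times t_1,\dots,\mu_r\times t_r)$ denotes the sequence in which $\mu_i$ is repeated $t_i$ times; an entry $\mu$ without "$\times t$" is a single part, and $\mu\times 0$ contributes no parts. -}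

module Defs where

open import Data.Nat using (ℕ; zero; suc; _≥_)
open import Data.Integer using (ℤ; +_; _-_; _*_; _+_)
open import Data.Integer.DivMod using (_/_)
open import Data.List using (List; []; _∷_)
open import Data.Nat.ListAction using (sum)
open import Data.Product using (_×_)
open import Data.Unit using (⊤)
open import Relation.Binary.PropositionalEquality using (_≡_)

-- ρ-term for part x at (1-based) position i :  x (x - 2 i + 1) / 2   (always an exact integer)
ρterm : ℕ → ℕ → ℤ
ρterm i x = ((+ x) * (+ x - (+ 2) * (+ i) + + 1)) / (+ 2)

ρFrom : ℕ → List ℕ → ℤ
ρFrom i [] = + 0
ρFrom i (x ∷ xs) = ρterm i x + ρFrom (suc i) xs

ρ : List ℕ → ℤ
ρ = ρFrom 1

NonIncreasing : List ℕ → Set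
NonIncreasing [] = ⊤
NonIncreasing (x ∷ []) = ⊤
NonIncreasing (x ∷ y ∷ xs) = x ≥ y × NonIncreasing (y ∷ xs)

AllPositive : List ℕ → Set
AllPositive [] = ⊤
AllPositive (x ∷ xs) = x ≥ 1 × AllPositive xs

IsPartitionOf : ℕ → List ℕ → Set
IsPartitionOf n λs = AllPositive λs × NonIncreasing λs × sum λs ≡ n

CorrespondsTo : List ℕ → ℤ → Set
CorrespondsTo λs e = ρ λs ≡ e

{-# OPTIONS --safe #-}
module Submission where

-- Since x(x - 2i + 1)/2 = C(x,2) - (i-1)x, writing n - a = 2(3 + j) the partition is
-- (3 + j, a + 1, 2, 1ʲ) and its ρ is C(3+j,2) + C(a+1,2) - (a+1) + (1 - 4) - (3j + C(j,2)),
-- which collapses to C(a,2) - 1 by C(m+n,2) = C(m,2) + mn + C(n,2). The bound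
-- a ≤ ⌊(n-2)/3⌋ is exactly what makes the parts non-increasing: a + 1 ≤ (n - a)/2.

open import Defs
open import Data.Nat using (ℕ; _≤_; _∸_; _+_; _/_)
open import Data.Nat.Divisibility using (_∣_)
open import Data.Nat.Combinatorics using (_C_)
open import Data.Integer using (ℤ; +_; _-_)
open import Data.List using (List; _∷_; replicate)
open import Data.Product using (_×_)

open import Data.Nat using (zero; suc; _*_; _%_; NonZero; s≤s; z≤n)
open import Data.Nat.Properties
  using (≤-refl; ≤-trans; <⇒≤; m≤m+n; m≤n+m; m≤m*n; +-monoˡ-≤; *-monoˡ-≤; +-cancelˡ-≤;
         *-cancelʳ-≤; m∸n+n≡m; m+[n∸m]≡n; m+n∸m≡n; m≤n⇒∃[o]m+o≡n)
open import Data.Nat.Combinatorics using (nC1≡n; nCk+nC[k+1]≡[n+1]C[k+1])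
open import Data.Nat.DivMod using (m/n*n≤m; m*n/n≡m; m*n%n≡0)
open import Data.Nat.Divisibility using (divides)
open import Data.Nat.ListAction using (sum)
import Data.Integer as ℤ
open import Data.Integer using (-[1+_]; -_; _/ℕ_)
open import Data.Integer.Properties using (pos-*; *-zeroʳ)
open import Data.Integer.DivMod using (div-pos-is-/ℕ)
open import Data.Product using (_,_; ∃-syntax)
open import Data.Unit using (tt)
open import Relation.Binary.PropositionalEquality
open ≡-Reasoning
import Data.Nat.Tactic.RingSolver as ℕ-Ring
import Data.Integer.Tactic.RingSolver as ℤ-Ring

-[1+m]/ℕd≡-[[1+m]/d] : ∀ m d .{{_ : NonZero d}} → suc m % d ≡ 0 → -[1+ m ] /ℕ d ≡ - + (suc m / d)
-[1+m]/ℕd≡-[[1+m]/d] m d d∣1+m with suc m % d | d∣1+m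
... | 0 | refl = refl

[i*d]/ℕd≡i : ∀ i d .{{_ : NonZero d}} → (i ℤ.* + d) /ℕ d ≡ i
[i*d]/ℕd≡i (+ n)    d rewrite sym (pos-* n d) = cong +_ (m*n/n≡m n d)
[i*d]/ℕd≡i -[1+ n ] d@(suc d-1) = begin
  -[1+ d-1 + n * d ] /ℕ d   ≡⟨ -[1+m]/ℕd≡-[[1+m]/d] (d-1 + n * d) d (m*n%n≡0 (suc n) d) ⟩
  - + (suc n * d / d)       ≡⟨ cong (λ k → - + k) (m*n/n≡m (suc n) d) ⟩
  -[1+ n ]                  ∎

[i*d]/d≡i : ∀ i d .{{_ : NonZero d}} → (i ℤ.* + d) ℤ./ + d ≡ i
[i*d]/d≡i i d = trans (div-pos-is-/ℕ (i ℤ.* + d) d) ([i*d]/ℕd≡i i d)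

[1+n]C2≡n+nC2 : ∀ n → suc n C 2 ≡ n + n C 2
[1+n]C2≡n+nC2 n = begin
  suc n C 2     ≡⟨ nCk+nC[k+1]≡[n+1]C[k+1] n 1 ⟨
  n C 1 + n C 2 ≡⟨ cong (_+ n C 2) (nC1≡n n) ⟩
  n + n C 2     ∎

[m+n]C2≡mC2+m*n+nC2 : ∀ m n → (m + n) C 2 ≡ m C 2 + m * n + n C 2
[m+n]C2≡mC2+m*n+nC2 zero    n = refl
[m+n]C2≡mC2+m*n+nC2 (suc m) n = begin
  suc (m + n) C 2                   ≡⟨ [1+n]C2≡n+nC2 (m + n) ⟩
  m + n + (m + n) C 2               ≡⟨ cong (_+_ (m + n)) ([m+n]C2≡mC2+m*n+nC2 m n) ⟩
  m + n + (m C 2 + m * n + n C 2)   ≡⟨ regroup m n (m C 2) (m * n) (n C 2) ⟩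
  m + m C 2 + (n + m * n) + n C 2   ≡⟨ cong (λ c → c + suc m * n + n C 2) ([1+n]C2≡n+nC2 m) ⟨
  suc m C 2 + suc m * n + n C 2     ∎
  where
  regroup : ∀ m n c p d → m + n + (c + p + d) ≡ m + c + (n + p) + d
  regroup = ℕ-Ring.solve-∀

nC2*2+n≡n*n : ∀ n → (n C 2) * 2 + n ≡ n * n
nC2*2+n≡n*n zero    = refl
nC2*2+n≡n*n (suc n) = begin
  (suc n C 2) * 2 + suc n           ≡⟨ cong (λ c → c * 2 + suc n) ([1+n]C2≡n+nC2 n) ⟩
  (n + n C 2) * 2 + suc n           ≡⟨ regroup n (n C 2) ⟩
  suc (n * 2 + ((n C 2) * 2 + n))   ≡⟨ cong (λ s → suc (n * 2 + s)) (nC2*2+n≡n*n n) ⟩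
  suc (n * 2 + n * n)               ≡⟨ square n ⟩
  suc n * suc n                     ∎
  where
  regroup : ∀ n c → (n + c) * 2 + suc n ≡ suc (n * 2 + (c * 2 + n))
  regroup = ℕ-Ring.solve-∀
  square : ∀ n → suc (n * 2 + n * n) ≡ suc n * suc n
  square = ℕ-Ring.solve-∀

ρterm[1+i]x≡xC2-i*x : ∀ i x → ρterm (suc i) x ≡ + (x C 2) - + i ℤ.* + x
ρterm[1+i]x≡xC2-i*x i x = begin
  (+ x ℤ.* (+ x - + 2 ℤ.* + suc i ℤ.+ + 1)) ℤ./ + 2   ≡⟨ cong (ℤ._/ + 2) (halve (+ x) (+ i) (+ (x C 2)) binomial) ⟩
  ((+ (x C 2) - + i ℤ.* + x) ℤ.* + 2) ℤ./ + 2         ≡⟨ [i*d]/d≡i _ 2 ⟩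
  + (x C 2) - + i ℤ.* + x                             ∎
  where
  binomial : + (x C 2) ℤ.* + 2 ℤ.+ + x ≡ + x ℤ.* + x
  binomial = begin
    + (x C 2) ℤ.* + 2 ℤ.+ + x   ≡⟨ cong (ℤ._+ + x) (pos-* (x C 2) 2) ⟨
    + ((x C 2) * 2 + x)         ≡⟨ cong +_ (nC2*2+n≡n*n x) ⟩
    + (x * x)                   ≡⟨ pos-* x x ⟩
    + x ℤ.* + x                 ∎
  halve : ∀ x i c → c ℤ.* + 2 ℤ.+ x ≡ x ℤ.* x →
          x ℤ.* (x - + 2 ℤ.* (+ 1 ℤ.+ i) ℤ.+ + 1) ≡ (c - i ℤ.* x) ℤ.* + 2
  halve x i c c*2+x≡x*x = begin
    x ℤ.* (x - + 2 ℤ.* (+ 1 ℤ.+ i) ℤ.+ + 1)   ≡⟨ expand x i ⟩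
    x ℤ.* x - x - + 2 ℤ.* i ℤ.* x             ≡⟨ cong (λ s → s - x - + 2 ℤ.* i ℤ.* x) c*2+x≡x*x ⟨
    c ℤ.* + 2 ℤ.+ x - x - + 2 ℤ.* i ℤ.* x     ≡⟨ collect x i c ⟩
    (c - i ℤ.* x) ℤ.* + 2                     ∎
    where
    expand : ∀ x i → x ℤ.* (x - + 2 ℤ.* (+ 1 ℤ.+ i) ℤ.+ + 1) ≡ x ℤ.* x - x - + 2 ℤ.* i ℤ.* x
    expand = ℤ-Ring.solve-∀
    collect : ∀ x i c → c ℤ.* + 2 ℤ.+ x - x - + 2 ℤ.* i ℤ.* x ≡ (c - i ℤ.* x) ℤ.* + 2
    collect = ℤ-Ring.solve-∀

ρFrom[1+i]1ʲ≡-[i*j+jC2] : ∀ i j → ρFrom (suc i) (replicate j 1) ≡ - (+ i ℤ.* + j ℤ.+ + (j C 2))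
ρFrom[1+i]1ʲ≡-[i*j+jC2] i zero    = cong (λ k → - (k ℤ.+ + 0)) (sym (*-zeroʳ (+ i)))
ρFrom[1+i]1ʲ≡-[i*j+jC2] i (suc j) = begin
  ρterm (suc i) 1 ℤ.+ ρFrom (suc (suc i)) (replicate j 1)
    ≡⟨ cong₂ ℤ._+_ (ρterm[1+i]x≡xC2-i*x i 1) (ρFrom[1+i]1ʲ≡-[i*j+jC2] (suc i) j) ⟩
  (+ 0 - + i ℤ.* + 1) ℤ.+ - ((+ 1 ℤ.+ + i) ℤ.* + j ℤ.+ + (j C 2))
    ≡⟨ regroup (+ i) (+ j) (+ (j C 2)) ⟩
  - (+ i ℤ.* (+ 1 ℤ.+ + j) ℤ.+ (+ j ℤ.+ + (j C 2)))
    ≡⟨ cong (λ c → - (+ i ℤ.* + suc j ℤ.+ + c)) ([1+n]C2≡n+nC2 j) ⟨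
  - (+ i ℤ.* + suc j ℤ.+ + (suc j C 2))
    ∎
  where
  regroup : ∀ i j c → (+ 0 - i ℤ.* + 1) ℤ.+ - ((+ 1 ℤ.+ i) ℤ.* j ℤ.+ c) ≡ - (i ℤ.* (+ 1 ℤ.+ j) ℤ.+ (j ℤ.+ c))
  regroup = ℤ-Ring.solve-∀

ρ[3+j,a+1,2,1ʲ]≡aC2-1 : ∀ a j → ρ ((3 + j) ∷ (a + 1) ∷ 2 ∷ replicate j 1) ≡ + (a C 2) - + 1
ρ[3+j,a+1,2,1ʲ]≡aC2-1 a j =
  trans (cong₂ ℤ._+_ (ρterm[1+i]x≡xC2-i*x 0 (3 + j))
          (cong₂ ℤ._+_ (ρterm[1+i]x≡xC2-i*x 1 (a + 1))
            (cong₂ ℤ._+_ (ρterm[1+i]x≡xC2-i*x 2 2) (ρFrom[1+i]1ʲ≡-[i*j+jC2] 3 j))))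
        (cancel (+ j) (+ a) (+ (j C 2)) (+ (a C 2)) (+[m+n]C2 3 j) (+[m+n]C2 a 1))
  where
  +[m+n]C2 : ∀ m n → + ((m + n) C 2) ≡ + (m C 2) ℤ.+ + m ℤ.* + n ℤ.+ + (n C 2)
  +[m+n]C2 m n = trans (cong +_ ([m+n]C2≡mC2+m*n+nC2 m n))
                       (cong (λ p → + (m C 2) ℤ.+ p ℤ.+ + (n C 2)) (pos-* m n))
  cancel : ∀ j a cj ca {c₃ c₁} → c₃ ≡ + 3 ℤ.+ + 3 ℤ.* j ℤ.+ cj → c₁ ≡ ca ℤ.+ a ℤ.* + 1 ℤ.+ + 0 →
    (c₃ - + 0 ℤ.* (+ 3 ℤ.+ j)) ℤ.+ ((c₁ - + 1 ℤ.* (a ℤ.+ + 1)) ℤ.+ ((+ 1 - + 2 ℤ.* + 2) ℤ.+ - (+ 3 ℤ.* j ℤ.+ cj)))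
      ≡ ca - + 1
  cancel j a cj ca refl refl = ring j a cj ca
    where
    ring : ∀ j a cj ca →
      ((+ 3 ℤ.+ + 3 ℤ.* j ℤ.+ cj) - + 0 ℤ.* (+ 3 ℤ.+ j)) ℤ.+
      (((ca ℤ.+ a ℤ.* + 1 ℤ.+ + 0) - + 1 ℤ.* (a ℤ.+ + 1)) ℤ.+ ((+ 1 - + 2 ℤ.* + 2) ℤ.+ - (+ 3 ℤ.* j ℤ.+ cj)))
        ≡ ca - + 1
    ring = ℤ-Ring.solve-∀

sum-replicate : ∀ j x → sum (replicate j x) ≡ j * x
sum-replicate zero    x = refl
sum-replicate (suc j) x = cong (_+_ x) (sum-replicate j x)

allPositive-replicate : ∀ j {x} → 1 ≤ x → AllPositive (replicate j x)
allPositive-replicate zero    1≤x = tt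
allPositive-replicate (suc j) 1≤x = 1≤x , allPositive-replicate j 1≤x

nonIncreasing-∷-replicate : ∀ j {x y} → x ≤ y → NonIncreasing (y ∷ replicate j x)
nonIncreasing-∷-replicate zero    x≤y = tt
nonIncreasing-∷-replicate (suc j) x≤y = x≤y , nonIncreasing-∷-replicate j ≤-refl

[3+j,a+1,2,1ʲ]-isPartitionOf : ∀ a j → 1 ≤ a → a + 1 ≤ 3 + j →
  IsPartitionOf (a + (3 + j) * 2) ((3 + j) ∷ (a + 1) ∷ 2 ∷ replicate j 1)
[3+j,a+1,2,1ʲ]-isPartitionOf a j 1≤a a+1≤3+j =
  (s≤s z≤n , m≤n+m 1 a , s≤s z≤n , allPositive-replicate j ≤-refl) ,
  (a+1≤3+j , +-monoˡ-≤ 1 1≤a , nonIncreasing-∷-replicate j (s≤s z≤n)) ,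
  trans (cong (λ s → 3 + j + (a + 1 + (2 + s))) (sum-replicate j 1)) (regroup a j)
  where
  regroup : ∀ a j → 3 + j + (a + 1 + (2 + j * 1)) ≡ a + (3 + j) * 2
  regroup = ℕ-Ring.solve-∀

m≤[n∸k]/d⇒m*d+k≤n : ∀ {m n} k d .{{_ : NonZero d}} → k ≤ n → m ≤ (n ∸ k) / d → m * d + k ≤ n
m≤[n∸k]/d⇒m*d+k≤n {m} {n} k d k≤n m≤[n∸k]/d =
  subst (m * d + k ≤_) (m∸n+n≡m k≤n)
    (+-monoˡ-≤ k (≤-trans (*-monoˡ-≤ d m≤[n∸k]/d) (m/n*n≤m (n ∸ k) d)))

∃[q]n≡a+q*2×a+1≤q : ∀ {n a} → 2 ≤ n → a ≤ (n ∸ 2) / 3 → 2 ∣ n ∸ a →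
  ∃[ q ] n ≡ a + q * 2 × a + 1 ≤ q
∃[q]n≡a+q*2×a+1≤q {n} {a} 2≤n a≤[n∸2]/3 (divides q n∸a≡q*2) = q , n≡a+q*2 , a+1≤q
  where
  a*3+2≤n : a * 3 + 2 ≤ n
  a*3+2≤n = m≤[n∸k]/d⇒m*d+k≤n 2 3 2≤n a≤[n∸2]/3
  n≡a+q*2 : n ≡ a + q * 2
  n≡a+q*2 = trans (sym (m+[n∸m]≡n (≤-trans (m≤m*n a 3) (≤-trans (m≤m+n _ 2) a*3+2≤n))))
                  (cong (_+_ a) n∸a≡q*2)
  a+1≤q : a + 1 ≤ q
  a+1≤q = *-cancelʳ-≤ (a + 1) q 2 (+-cancelˡ-≤ a _ _
            (subst₂ _≤_ (regroup a) n≡a+q*2 a*3+2≤n))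
    where
    regroup : ∀ a → a * 3 + 2 ≡ a + (a + 1) * 2
    regroup = ℕ-Ring.solve-∀

lemma3p7 : (n a : ℕ) → 10 ≤ n → 2 ≤ a → a ≤ (n ∸ 2) / 3 → 2 ∣ (n ∸ a) →
    IsPartitionOf n (((n ∸ a) / 2) ∷ (a + 1) ∷ 2 ∷ replicate ((n ∸ a ∸ 6) / 2) 1)
    × CorrespondsTo (((n ∸ a) / 2) ∷ (a + 1) ∷ 2 ∷ replicate ((n ∸ a ∸ 6) / 2) 1)
        (+ (a C 2) - + 1)
lemma3p7 n a 10≤n 2≤a a≤[n∸2]/3 2∣n∸a
  with q , refl , a+1≤q ← ∃[q]n≡a+q*2×a+1≤q (≤-trans (s≤s (s≤s z≤n)) 10≤n) a≤[n∸2]/3 2∣n∸a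
  with j , refl ← m≤n⇒∃[o]m+o≡n (≤-trans (+-monoˡ-≤ 1 2≤a) a+1≤q)
  -- rewrite does not insert the NonZero instances by itself
  rewrite m+n∸m≡n a ((3 + j) * 2) | m*n/n≡m (3 + j) 2 ⦃ _ ⦄ | m*n/n≡m j 2 ⦃ _ ⦄
  = [3+j,a+1,2,1ʲ]-isPartitionOf a j (<⇒≤ 2≤a) a+1≤q , ρ[3+j,a+1,2,1ʲ]≡aC2-1 a j
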